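{- Let $\psi$ be a locally bijective homomorphism from a graph $G$ to a graph $H$. Then the map $\psi'\colon E(G)\to E(H)$ defined by $\psi'(uv)=\psi(u)\psi(v)$ for every edge $uv\in E(G)$ is a locally bijective homomorphism from $L(G)$ to $L(H)$.
   Context: Graphs are finite and simple; $L(\cdot)$ is the line graph (vertex set the edge set, adjacency meaning sharing an endpoint). A locally bijective homomorphism from $G$ to $H$ is a map $\psi\colon V(G)\to V(H)$ such that for every $v\in V(G)$ the restriction of $\psi$ to $N_G(v)$ is a bijection onto $N_H(\psi(v))$. -}

module Defs where

open import Data.Nat using (ℕ)
open import Data.Fin using (Fin; _<_)
open import Data.Bool using (Bool; T)
open import Data.Product using (Σ; ∃; _×_; _,_; proj₁; proj₂)
open import Data.Sum using (_⊎_)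
open import Relation.Binary.PropositionalEquality using (_≡_; _≢_)

record Graph (n : ℕ) : Set where
  field
    adj    : Fin n → Fin n → Bool
    sym    : ∀ u v → adj u v ≡ adj v u
    irrefl : ∀ u → adj u u ≡ Data.Bool.false

open Graph public

Adj : ∀ {n} → Graph n → Fin n → Fin n → Set
Adj G u v = T (adj G u v)

-- Edges of G: unordered pairs {u,v}, canonically represented by u < v.
Edge : ∀ {n} → Graph n → Set
Edge {n} G = Σ (Fin n × Fin n) λ p → (proj₁ p < proj₂ p) × Adj G (proj₁ p) (proj₂ p)

end₁ : ∀ {n} {G : Graph n} → Edge G → Fin n
end₁ e = proj₁ (proj₁ e)

end₂ : ∀ {n} {G : Graph n} → Edge G → Fin n
end₂ e = proj₂ (proj₁ e)

ShareEnd : ∀ {n} {G : Graph n} → Edge G → Edge G → Set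
ShareEnd {G = G} e f =
  (end₁ {G = G} e ≡ end₁ {G = G} f ⊎ end₁ {G = G} e ≡ end₂ {G = G} f)
  ⊎ (end₂ {G = G} e ≡ end₁ {G = G} f ⊎ end₂ {G = G} e ≡ end₂ {G = G} f)

LAdj : ∀ {n} (G : Graph n) → Edge G → Edge G → Set
LAdj G e f = (e ≢ f) × ShareEnd {G = G} e f

LocallyBijective : {V W : Set} (AdjG : V → V → Set) (AdjH : W → W → Set)
                   (ψ : V → W) → Set
LocallyBijective {V} {W} AdjG AdjH ψ = ∀ v →
    (∀ w → AdjG v w → AdjH (ψ v) (ψ w))
  × (∀ w w′ → AdjG v w → AdjG v w′ → ψ w ≡ ψ w′ → w ≡ w′)
  × (∀ y → AdjH (ψ v) y → Σ V λ w → AdjG v w × ψ w ≡ y)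

{-# OPTIONS --safe #-}
-- Say that an edge e joins u and v if {u, v} are its endpoints. If e joins u
-- and v, then ψ u and ψ v are adjacent, so some edge ψ′ e joins them. Two edges
-- of L(G) are adjacent iff they meet in a vertex u, and the edges at u
-- correspond to the neighbours of u; local bijectivity of ψ at u therefore makes
-- ψ′ bijective between the edges at u and the edges at ψ u. The one remaining
-- case, neighbours f = {u, w}, f′ = {v, w′} of e = {u, v} with the same image,
-- forces ψ u = ψ w′, hence u = w′ by local injectivity at v, i.e. f′ = e.
module Submission where

open import Defs hiding (sym)
open import Data.Nat using (ℕ)
open import Data.Fin using (Fin)
open import Data.Fin.Properties using (<-cmp; <-asym; <-irrelevant)
open import Data.Bool using (false; T)
open import Data.Bool.Properties using (T-irrelevant)
open import Data.Product using (Σ; ∃; ∃₂; _×_; _,_; proj₁; proj₂)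
open import Data.Product.Properties using (×-≡,≡→≡)
open import Data.Sum using (_⊎_; inj₁; inj₂)
open import Data.Empty using (⊥-elim)
open import Relation.Binary.Definitions using (tri<; tri≈; tri>)
open import Relation.Binary.PropositionalEquality
  using (_≡_; _≢_; refl; sym; trans; cong; subst)

module _ {n : ℕ} (G : Graph n) where

  Adj⇒≢ : ∀ {u v} → Adj G u v → u ≢ v
  Adj⇒≢ {u} a refl with adj G u u | irrefl G u
  ... | .false | refl = a

  Adj-sym : ∀ {u v} → Adj G u v → Adj G v u
  Adj-sym {u} {v} = subst T (Graph.sym G u v)

  Edge-≡ : ∀ {e f} → end₁ {G = G} e ≡ end₁ {G = G} f → end₂ {G = G} e ≡ end₂ {G = G} f →
           e ≡ f
  Edge-≡ {(_ , _) , lt , a} {(_ , _) , lt′ , a′} refl refl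
    rewrite <-irrelevant lt lt′ | T-irrelevant a a′ = refl

data Joins {n : ℕ} (G : Graph n) (e : Edge G) (u v : Fin n) : Set where
  forwards  : end₁ {G = G} e ≡ u → end₂ {G = G} e ≡ v → Joins G e u v
  backwards : end₁ {G = G} e ≡ v → end₂ {G = G} e ≡ u → Joins G e u v

Joins-ends : ∀ {n} (G : Graph n) e → Joins G e (end₁ {G = G} e) (end₂ {G = G} e)
Joins-ends G e = forwards refl refl

module _ {n : ℕ} {G : Graph n} where

  Joins-swap : ∀ {e : Edge G} {u v} → Joins G e u v → Joins G e v u
  Joins-swap (forwards p q)  = backwards p q
  Joins-swap (backwards p q) = forwards p q

  Joins⇒Adj : ∀ {e : Edge G} {u v} → Joins G e u v → Adj G u v
  Joins⇒Adj {_ , _ , a} (forwards refl refl)  = a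
  Joins⇒Adj {_ , _ , a} (backwards refl refl) = Adj-sym G a

  ends-unique : ∀ {e : Edge G} {u v x y} → Joins G e u v → Joins G e x y →
                (u ≡ x × v ≡ y) ⊎ (u ≡ y × v ≡ x)
  ends-unique (forwards refl refl)  (forwards refl refl)  = inj₁ (refl , refl)
  ends-unique (forwards refl refl)  (backwards refl refl) = inj₂ (refl , refl)
  ends-unique (backwards refl refl) (forwards refl refl)  = inj₂ (refl , refl)
  ends-unique (backwards refl refl) (backwards refl refl) = inj₁ (refl , refl)

  other-end-unique : ∀ {e : Edge G} {u v w} → Joins G e u v → Joins G e u w → v ≡ w
  other-end-unique p q with ends-unique p q
  ... | inj₁ (_ , v≡w)     = v≡w
  ... | inj₂ (refl , refl) = ⊥-elim (Adj⇒≢ G (Joins⇒Adj p) refl)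

  edge-unique : ∀ {e f : Edge G} {u v} → Joins G e u v → Joins G f u v → e ≡ f
  edge-unique (forwards refl refl)  (forwards p q)  = Edge-≡ G (sym p) (sym q)
  edge-unique (backwards refl refl) (backwards p q) = Edge-≡ G (sym p) (sym q)
  edge-unique {_ , lt , _} {_ , lt′ , _} (forwards refl refl) (backwards refl refl) =
    ⊥-elim (<-asym lt lt′)
  edge-unique {_ , lt , _} {_ , lt′ , _} (backwards refl refl) (forwards refl refl) =
    ⊥-elim (<-asym lt lt′)

  Joins⇒ShareEnd : ∀ {e f : Edge G} {u v w} → Joins G e u v → Joins G f u w →
                   ShareEnd {G = G} e f
  Joins⇒ShareEnd (forwards p _)  (forwards q _)  = inj₁ (inj₁ (trans p (sym q)))
  Joins⇒ShareEnd (forwards p _)  (backwards _ q) = inj₁ (inj₂ (trans p (sym q)))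
  Joins⇒ShareEnd (backwards _ p) (forwards q _)  = inj₂ (inj₁ (trans p (sym q)))
  Joins⇒ShareEnd (backwards _ p) (backwards _ q) = inj₂ (inj₂ (trans p (sym q)))

  ShareEnd⇒Joins : ∀ {e f : Edge G} → ShareEnd {G = G} e f →
                   ∃₂ λ u v → ∃ λ w → Joins G e u v × Joins G f u w
  ShareEnd⇒Joins (inj₁ (inj₁ p)) = _ , _ , _ , forwards refl refl  , forwards (sym p) refl
  ShareEnd⇒Joins (inj₁ (inj₂ p)) = _ , _ , _ , forwards refl refl  , backwards refl (sym p)
  ShareEnd⇒Joins (inj₂ (inj₁ p)) = _ , _ , _ , backwards refl refl , forwards (sym p) refl
  ShareEnd⇒Joins (inj₂ (inj₂ p)) = _ , _ , _ , backwards refl refl , backwards refl (sym p)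

edgeBetween : ∀ {n} (G : Graph n) {u v} → Adj G u v → ∃ λ (e : Edge G) → Joins G e u v
edgeBetween G {u} {v} a with <-cmp u v
... | tri< u<v _ _ = ((u , v) , u<v , a) , forwards refl refl
... | tri≈ _ u≡v _ = ⊥-elim (Adj⇒≢ G a u≡v)
... | tri> _ _ v<u = ((v , u) , v<u , Adj-sym G a) , backwards refl refl

module LineGraphMap {n m} (G : Graph n) (H : Graph m) (ψ : Fin n → Fin m)
                    (ψ-lb : LocallyBijective (Adj G) (Adj H) ψ) where

  ψ-hom : ∀ {u v} → Adj G u v → Adj H (ψ u) (ψ v)
  ψ-hom {u} = proj₁ (ψ-lb u) _

  ψ-inj : ∀ {u v w} → Adj G u v → Adj G u w → ψ v ≡ ψ w → v ≡ w
  ψ-inj {u} = proj₁ (proj₂ (ψ-lb u)) _ _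

  ψ-surj : ∀ {u y} → Adj H (ψ u) y → ∃ λ w → Adj G u w × ψ w ≡ y
  ψ-surj {u} = proj₂ (proj₂ (ψ-lb u)) _

  lineMap-edgeBetween : ∀ e →
                        ∃ λ e′ → Joins H e′ (ψ (end₁ {G = G} e)) (ψ (end₂ {G = G} e))
  lineMap-edgeBetween e = edgeBetween H (ψ-hom (Joins⇒Adj (Joins-ends G e)))

  lineMap : Edge G → Edge H
  lineMap e = proj₁ (lineMap-edgeBetween e)

  lineMap-joins : ∀ {e u v} → Joins G e u v → Joins H (lineMap e) (ψ u) (ψ v)
  lineMap-joins {e} (forwards refl refl)  = proj₂ (lineMap-edgeBetween e)
  lineMap-joins {e} (backwards refl refl) = Joins-swap (proj₂ (lineMap-edgeBetween e))

  lineMap-injective-at : ∀ {e f u v w} → Joins G e u v → Joins G f u w →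
                         lineMap e ≡ lineMap f → e ≡ f
  lineMap-injective-at {u = u} p q eq = edge-unique p (subst (Joins G _ u) (sym v≡w) q)
    where
    ψv≡ψw = other-end-unique (lineMap-joins p)
                             (subst (λ g → Joins H g (ψ u) _) (sym eq) (lineMap-joins q))
    v≡w = ψ-inj (Joins⇒Adj p) (Joins⇒Adj q) ψv≡ψw

  lineMap-ends-preimage : ∀ {e x y} → Joins H (lineMap e) x y →
                          ∃₂ λ a b → Joins G e a b × ψ a ≡ x
  lineMap-ends-preimage {e} r with ends-unique (lineMap-joins (Joins-ends G e)) r
  ... | inj₁ (ψa≡x , _) = _ , _ , Joins-ends G e , ψa≡x
  ... | inj₂ (_ , ψb≡x) = _ , _ , Joins-swap (Joins-ends G e) , ψb≡x

  lineMap-ends : ∀ e →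
    ((end₁ {G = H} (lineMap e) , end₂ {G = H} (lineMap e)) ≡ (ψ (end₁ {G = G} e) , ψ (end₂ {G = G} e)))
    ⊎ ((end₁ {G = H} (lineMap e) , end₂ {G = H} (lineMap e)) ≡ (ψ (end₂ {G = G} e) , ψ (end₁ {G = G} e)))
  lineMap-ends e with lineMap-joins (Joins-ends G e)
  ... | forwards p q  = inj₁ (×-≡,≡→≡ (p , q))
  ... | backwards p q = inj₂ (×-≡,≡→≡ (p , q))

  lineMap-hom : ∀ e f → LAdj G e f → LAdj H (lineMap e) (lineMap f)
  lineMap-hom e f (e≢f , shared) with ShareEnd⇒Joins shared
  ... | _ , _ , _ , p , q =
    (λ eq → e≢f (lineMap-injective-at p q eq)) ,
    Joins⇒ShareEnd (lineMap-joins p) (lineMap-joins q)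

  lineMap-separates-ends : ∀ {e f f′ u v w w′} → Joins G e u v →
                           Joins G f u w → Joins G f′ v w′ → e ≢ f′ →
                           lineMap f ≢ lineMap f′
  lineMap-separates-ends {w′ = w′} p q q′ e≢f′ eq
    with ends-unique (lineMap-joins q)
                     (subst (λ g → Joins H g _ (ψ w′)) (sym eq) (lineMap-joins q′))
  ... | inj₁ (ψu≡ψv , _)  = Adj⇒≢ H (ψ-hom (Joins⇒Adj p)) ψu≡ψv
  ... | inj₂ (ψu≡ψw′ , _) =
    e≢f′ (edge-unique (Joins-swap p) (subst (Joins G _ _) (sym u≡w′) q′))
    where
    u≡w′ = ψ-inj (Adj-sym G (Joins⇒Adj p)) (Joins⇒Adj q′) ψu≡ψw′

  lineMap-inj : ∀ e f f′ → LAdj G e f → LAdj G e f′ → lineMap f ≡ lineMap f′ → f ≡ f′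
  lineMap-inj e f f′ (_ , shared) (e≢f′ , shared′) eq
    with ShareEnd⇒Joins shared | ShareEnd⇒Joins shared′
  ... | _ , _ , _ , p , q | _ , _ , _ , p′ , q′ with ends-unique p p′
  ... | inj₁ (refl , refl) = lineMap-injective-at q q′ eq
  ... | inj₂ (refl , refl) = ⊥-elim (lineMap-separates-ends p q q′ e≢f′ eq)

  lineMap-surj : ∀ e y → LAdj H (lineMap e) y → ∃ λ f → LAdj G e f × lineMap f ≡ y
  lineMap-surj e y (ψ′e≢y , shared) with ShareEnd⇒Joins shared
  ... | _ , _ , _ , r , s with lineMap-ends-preimage {e} r
  ... | a , _ , p , refl with ψ-surj (Joins⇒Adj s)
  ... | w , a~w , refl with edgeBetween G a~w
  ... | f , q =
    f , ((λ e≡f → ψ′e≢y (trans (cong lineMap e≡f) ψ′f≡y)) , Joins⇒ShareEnd p q) , ψ′f≡y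
    where
    ψ′f≡y = edge-unique (lineMap-joins q) s

lemma1 : ∀ {n m} (G : Graph n) (H : Graph m) (ψ : Fin n → Fin m) →
    LocallyBijective (Adj G) (Adj H) ψ →
    Σ (Edge G → Edge H) λ ψ′ →
      (∀ e → ((end₁ {G = H} (ψ′ e) , end₂ {G = H} (ψ′ e)) ≡ (ψ (end₁ {G = G} e) , ψ (end₂ {G = G} e)))
           ⊎ ((end₁ {G = H} (ψ′ e) , end₂ {G = H} (ψ′ e)) ≡ (ψ (end₂ {G = G} e) , ψ (end₁ {G = G} e))))
      × LocallyBijective (LAdj G) (LAdj H) ψ′
lemma1 G H ψ ψ-lb = lineMap , lineMap-ends , λ e → lineMap-hom e , lineMap-inj e , lineMap-surj e
  where open LineGraphMap G H ψ ψ-lb
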